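{- Let $G$ be a connected graph of even order. If the diameter of $G$ is at least $4$, then the complement $\overline{G}$ has a spanning tree which is an odd double star.
   Context: All graphs are finite and simple. The complement $\overline{G}$ has vertex set $V(G)$, two vertices being adjacent in $\overline{G}$ iff they are not adjacent in $G$. The diameter of $G$ is the maximum distance between two vertices of $G$. A double star is a tree with exactly two vertices of degree at least two; it is odd if every vertex has odd degree. -}

module Defs where

open import Data.Nat using (ℕ; zero; suc; _+_; _*_; _≤_)
open import Data.Bool using (Bool; true; false; not; _∧_; T; if_then_else_)
open import Data.Fin using (Fin; zero; suc; inject₁; fromℕ; _≟_)
open import Data.List using (List; allFin; map)
open import Data.Nat.ListAction using (sum)
open import Data.Product using (Σ; ∃; ∃-syntax; _×_; _,_)
open import Data.Sum using (_⊎_)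
open import Relation.Nullary using (¬_; ⌊_⌋)
open import Relation.Binary.PropositionalEquality using (_≡_; _≢_)
open import Function.Definitions using (Injective)

Even : ℕ → Set
Even n = ∃[ k ] n ≡ 2 * k

Odd : ℕ → Set
Odd n = ∃[ k ] n ≡ suc (2 * k)

record Graph (n : ℕ) : Set where
  field
    adj    : Fin n → Fin n → Bool
    adj-sym    : ∀ u v → adj u v ≡ adj v u
    adj-irrefl : ∀ v → adj v v ≡ false
open Graph public

module _ {n : ℕ} where

  Edge : Graph n → Fin n → Fin n → Set
  Edge G u v = T (adj G u v)

  complement : Graph n → Graph n
  complement G = record
    { adj    = λ u v → not (adj G u v) ∧ not ⌊ u ≟ v ⌋
    ; adj-sym    = symProof
    ; adj-irrefl = irreflProof
    }
    where
      open import Relation.Binary.PropositionalEquality using (refl; cong₂; sym)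
      open import Relation.Nullary using (yes; no)
      eqb : ∀ (u v : Fin n) → ⌊ u ≟ v ⌋ ≡ ⌊ v ≟ u ⌋
      eqb u v with u ≟ v | v ≟ u
      ... | yes _ | yes _ = refl
      ... | no _  | no _  = refl
      ... | yes p | no q  = Data.Empty.⊥-elim (q (sym p))
        where import Data.Empty
      ... | no p  | yes q = Data.Empty.⊥-elim (p (sym q))
        where import Data.Empty
      symProof : ∀ u v → (not (adj G u v) ∧ not ⌊ u ≟ v ⌋) ≡ (not (adj G v u) ∧ not ⌊ v ≟ u ⌋)
      symProof u v = cong₂ (λ a b → not a ∧ not b) (adj-sym G u v) (eqb u v)
      irreflProof : ∀ v → (not (adj G v v) ∧ not ⌊ v ≟ v ⌋) ≡ false
      irreflProof v with v ≟ v
      ... | yes _ = Data.Bool.Properties.∧-zeroʳ (not (adj G v v))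
        where import Data.Bool.Properties
      ... | no ¬p = Data.Empty.⊥-elim (¬p refl)
        where import Data.Empty

  data Walk (G : Graph n) : Fin n → Fin n → ℕ → Set where
    nil  : ∀ {u} → Walk G u u 0
    cons : ∀ {u w v k} → Edge G u w → Walk G w v k → Walk G u v (suc k)

  Connected : Graph n → Set
  Connected G = ∀ u v → ∃[ k ] Walk G u v k

  -- diam(G) ≥ d (for a connected G): some pair of vertices has distance ≥ d,
  -- i.e. every walk between them has length ≥ d.
  DiameterAtLeast : Graph n → ℕ → Set
  DiameterAtLeast G d = ∃[ u ] ∃[ v ] (∀ k → Walk G u v k → d ≤ k)

  HasCycle : Graph n → Set
  HasCycle G = ∃[ m ] Σ (Fin (suc (suc (suc m))) → Fin n) λ f →
      Injective _≡_ _≡_ f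
    × (∀ (i : Fin (suc (suc m))) → Edge G (f (inject₁ i)) (f (suc i)))
    × Edge G (f (fromℕ (suc (suc m)))) (f zero)

  Acyclic : Graph n → Set
  Acyclic G = ¬ HasCycle G

  IsTree : Graph n → Set
  IsTree G = Connected G × Acyclic G

  degree : Graph n → Fin n → ℕ
  degree G v = sum (map (λ w → if adj G v w then 1 else 0) (allFin n))

  SpanningSubgraph : Graph n → Graph n → Set
  SpanningSubgraph H G = ∀ u v → Edge H u v → Edge G u v

  IsDoubleStar : Graph n → Set
  IsDoubleStar T′ = IsTree T′ × ∃[ a ] ∃[ b ] (a ≢ b × 2 ≤ degree T′ a × 2 ≤ degree T′ b
                      × (∀ v → 2 ≤ degree T′ v → v ≡ a ⊎ v ≡ b))

  IsOddDoubleStar : Graph n → Set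
  IsOddDoubleStar T′ = IsDoubleStar T′ × (∀ v → Odd (degree T′ v))

-- Let u, v be at distance at least 4 in G. Then u and v are adjacent in the complement, and no
-- vertex is a G-neighbour of both, so every other vertex is adjacent in the complement to u or v.
-- Hanging the G-neighbours of v as leaves at u and all remaining vertices as leaves at v gives a
-- spanning double star of the complement whose centres have degrees 1 + ℓᵤ and 1 + ℓᵥ, where
-- ℓᵤ + ℓᵥ = n − 2 is even; so it is odd as soon as ℓᵤ is even. If ℓᵤ is odd, a vertex at distance
-- two from u (adjacent in G to neither u nor v) is moved from v to u.

module Submission where

open import Defs
open import Data.Nat using (ℕ; zero; suc; _+_; _≤_; _<_; _<ᵇ_; s≤s; z≤n)
open import Data.Nat.Properties using (+-suc; +-comm; *-comm; *-suc; <⇒≱; <ᵇ⇒<; m<n⇒m<1+n)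
open import Data.Nat.Divisibility using (_∣_; divides; ∣m+n∣m⇒∣n)
open import Data.Bool using (Bool; true; false; _∧_; _∨_; T; if_then_else_)
open import Data.Bool.Properties using (∨-comm; T-∨)
open import Data.Fin using (Fin; zero; suc; fromℕ; _≟_)
open import Data.List using (tabulate)
open import Data.List.Properties using (map-tabulate)
open import Data.Nat.ListAction using (sum)
open import Data.Product using (Σ; ∃-syntax; _×_; _,_; proj₂)
open import Data.Sum using (_⊎_; inj₁; inj₂; [_,_])
open import Data.Unit using (tt)
open import Data.Empty using (⊥; ⊥-elim)
open import Function using (id; _∘_)
open import Function.Bundles using (Equivalence)
open import Relation.Nullary using (¬_; yes; no; ⌊_⌋)
open import Relation.Nullary.Decidable using (⌊⌋-map′; toWitness; fromWitness; T?)
open import Relation.Binary.PropositionalEquality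
  using (module ≡-Reasoning; _≡_; _≢_; refl; sym; trans; cong; cong₂; subst)
open ≡-Reasoning

private variable
  n k l : ℕ

count : (Fin n → Bool) → ℕ
count p = sum (tabulate (λ w → if p w then 1 else 0))

degree≡count : (G : Graph n) (v : Fin n) → degree G v ≡ count (adj G v)
degree≡count G v = cong sum (map-tabulate id (λ w → if adj G v w then 1 else 0))

count-cong : {p q : Fin n → Bool} → (∀ w → p w ≡ q w) → count p ≡ count q
count-cong {zero}  p≗q = refl
count-cong {suc n} p≗q =
  cong₂ _+_ (cong (λ b → if b then 1 else 0) (p≗q zero)) (count-cong (p≗q ∘ suc))

count-∨ : {p q : Fin n → Bool} → (∀ w → p w ∧ q w ≡ false) →
          count (λ w → p w ∨ q w) ≡ count p + count q
count-∨ {zero}  disjoint = refl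
count-∨ {suc n} {p} {q} disjoint
  with p zero | q zero | disjoint zero | count-∨ {p = p ∘ suc} {q = q ∘ suc} (disjoint ∘ suc)
... | true  | true  | () | _
... | true  | false | _  | ih = cong suc ih
... | false | true  | _  | ih = trans (cong suc ih) (sym (+-suc _ _))
... | false | false | _  | ih = ih

count-true : count {n} (λ _ → true) ≡ n
count-true {zero}  = refl
count-true {suc n} = cong suc count-true

count-false : count {n} (λ _ → false) ≡ 0
count-false {zero}  = refl
count-false {suc n} = count-false {n}

count-singleton : (c : Fin n) → count (λ w → ⌊ w ≟ c ⌋) ≡ 1
count-singleton {suc n} zero    = cong suc (count-false {n})
count-singleton {suc n} (suc c) = trans (count-cong (λ w → ⌊⌋-map′ _ _ (w ≟ c))) (count-singleton c)

count-unique : (p : Fin n → Bool) {c : Fin n} → T (p c) → (∀ {w} → T (p w) → w ≡ c) → count p ≡ 1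
count-unique p {c} pc unique = trans (count-cong p≗singleton) (count-singleton c)
  where
  p≗singleton : ∀ w → p w ≡ ⌊ w ≟ c ⌋
  p≗singleton w with w ≟ c | p w in pw
  ... | yes refl | true  = refl
  ... | yes refl | false = ⊥-elim (subst T pw pc)
  ... | no _     | false = refl
  ... | no w≢c   | true  = ⊥-elim (w≢c (unique (subst T (sym pw) tt)))

count-insert : (p : Fin n → Bool) {c : Fin n} → ¬ T (p c) →
               count (λ w → p w ∨ ⌊ w ≟ c ⌋) ≡ suc (count p)
count-insert p {c} ¬pc =
  trans (count-∨ disjoint) (trans (cong (count p +_) (count-singleton c)) (+-comm _ 1))
  where
  disjoint : ∀ w → p w ∧ ⌊ w ≟ c ⌋ ≡ false
  disjoint w with w ≟ c | p w in pw
  ... | no _     | false = refl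
  ... | no _     | true  = refl
  ... | yes _    | false = refl
  ... | yes refl | true  = ⊥-elim (¬pc (subst T (sym pw) tt))

count-positive : (p : Fin n → Bool) {w : Fin n} → T (p w) → 0 < count p
count-positive p {zero}  pw with p zero
... | true = s≤s z≤n
count-positive p {suc w} pw with p zero
... | true  = s≤s z≤n
... | false = count-positive (p ∘ suc) pw

even⇒2∣ : {m : ℕ} → Even m → 2 ∣ m
even⇒2∣ (q , m≡2q) = divides q (trans m≡2q (*-comm 2 q))

2∣⇒even : {m : ℕ} → 2 ∣ m → Even m
2∣⇒even (divides q m≡q2) = q , trans m≡q2 (*-comm q 2)

even-+-cancelˡ : {m k : ℕ} → Even m → Even (m + k) → Even k
even-+-cancelˡ em emk = 2∣⇒even (∣m+n∣m⇒∣n (even⇒2∣ emk) (even⇒2∣ em))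

odd⇒even-suc : {m : ℕ} → Odd m → Even (suc m)
odd⇒even-suc (q , m≡1+2q) = suc q , trans (cong suc m≡1+2q) (sym (*-suc 2 q))

even⊎odd : ∀ m → Even m ⊎ Odd m
even⊎odd zero = inj₁ (0 , refl)
even⊎odd (suc m) with even⊎odd m
... | inj₁ (q , m≡2q) = inj₂ (q , cong suc m≡2q)
... | inj₂ m-odd      = inj₁ (odd⇒even-suc m-odd)

module _ (G : Graph n) where

  edge-sym : ∀ {x y} → Edge G x y → Edge G y x
  edge-sym {x} {y} = subst T (adj-sym G x y)

  edge-irrefl : ∀ {x} → ¬ Edge G x x
  edge-irrefl {x} = subst T (adj-irrefl G x)

  edge⇒≢ : ∀ {x y} → Edge G x y → x ≢ y
  edge⇒≢ e refl = edge-irrefl e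

  complement-edge : ∀ {x y} → ¬ Edge G x y → x ≢ y → Edge (complement G) x y
  complement-edge {x} {y} ¬xy x≢y with adj G x y | x ≟ y
  ... | true  | _       = ¬xy tt
  ... | false | yes x≡y = x≢y x≡y
  ... | false | no _    = tt

module _ {G : Graph n} where

  _++ʷ_ : ∀ {x y z} → Walk G x y k → Walk G y z l → Walk G x z (k + l)
  nil      ++ʷ q = q
  cons e p ++ʷ q = cons e (p ++ʷ q)

  snocʷ : ∀ {x y z} → Walk G x y k → Edge G y z → Walk G x z (suc k)
  snocʷ nil        e = cons e nil
  snocʷ (cons d p) e = cons d (snocʷ p e)

  reverseʷ : ∀ {x y} → Walk G x y k → Walk G y x k
  reverseʷ nil        = nil
  reverseʷ (cons e p) = snocʷ (reverseʷ p) (edge-sym G e)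

  connected-via : (c : Fin n) → (∀ x → ∃[ k ] Walk G x c k) → Connected G
  connected-via c reach x y with reach x | reach y
  ... | _ , p | _ , q = _ , p ++ʷ reverseʷ q

  neighbour : Connected G → ∀ {x y} → x ≢ y → ∃[ w ] Edge G x w
  neighbour connected {x} {y} x≢y with connected x y
  ... | _ , nil      = ⊥-elim (x≢y refl)
  ... | _ , cons e _ = _ , e

pigeonhole : ∀ {A : Set} {a b x y z : A} → x ≡ a ⊎ x ≡ b → y ≡ a ⊎ y ≡ b → z ≡ a ⊎ z ≡ b →
             x ≢ y → x ≢ z → y ≢ z → ⊥
pigeonhole (inj₁ refl) (inj₁ refl) _           x≢y _   _   = x≢y refl
pigeonhole (inj₂ refl) (inj₂ refl) _           x≢y _   _   = x≢y refl
pigeonhole (inj₁ refl) (inj₂ refl) (inj₁ refl) _   x≢z _   = x≢z refl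
pigeonhole (inj₁ refl) (inj₂ refl) (inj₂ refl) _   _   y≢z = y≢z refl
pigeonhole (inj₂ refl) (inj₁ refl) (inj₁ refl) _   _   y≢z = y≢z refl
pigeonhole (inj₂ refl) (inj₁ refl) (inj₂ refl) _   x≢z _   = x≢z refl

-- Every vertex of a cycle has two distinct neighbours on it, and a cycle has at least three
-- vertices.
two-branch-points⇒acyclic : (G : Graph n) {a b : Fin n} →
  (∀ {x y z} → Edge G x y → Edge G x z → y ≢ z → x ≡ a ⊎ x ≡ b) → Acyclic G
two-branch-points⇒acyclic G branch (m , f , f-injective , path , closing) =
  pigeonhole first second last (distinct λ ()) (distinct λ ()) (distinct λ ())
  where
  distinct : ∀ {i j} → i ≢ j → f i ≢ f j
  distinct i≢j = i≢j ∘ f-injective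
  first  = branch (path zero) (edge-sym G closing) (distinct λ ())
  second = branch (edge-sym G (path zero)) (path (suc zero)) (distinct λ ())
  last   = branch closing (edge-sym G (path (fromℕ (suc m)))) (distinct λ ())

HasSpanningOddDoubleStar : Graph n → Set
HasSpanningOddDoubleStar G = Σ (Graph _) λ T′ → SpanningSubgraph T′ G × IsOddDoubleStar T′

-- The four positions on the path leafA — centreA — centreB — leafB; a double star is the
-- pull-back of this path along a labelling whose two centre fibres are singletons.
Role : Set
Role = Fin 4

pattern leafA   = zero
pattern centreA = suc zero
pattern centreB = suc (suc zero)
pattern leafB   = suc (suc (suc zero))

pathStep : Role → Role → Bool
pathStep leafA   centreA = true
pathStep centreA centreB = true
pathStep centreB leafB   = true
pathStep _       _       = false

linked : Role → Role → Bool
linked r q = pathStep r q ∨ pathStep q r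

linked-sym : ∀ r q → linked r q ≡ linked q r
linked-sym r q = ∨-comm (pathStep r q) (pathStep q r)

everyRole : (P : Role → Set) → P leafA → P centreA → P centreB → P leafB → ∀ r → P r
everyRole P pA cA cB pB leafA   = pA
everyRole P pA cA cB pB centreA = cA
everyRole P pA cA cB pB centreB = cB
everyRole P pA cA cB pB leafB   = pB

linked-irrefl : ∀ r → linked r r ≡ false
linked-irrefl = everyRole _ refl refl refl refl

linked-leafA : ∀ {q} → T (linked leafA q) → q ≡ centreA
linked-leafA {leafA}   ()
linked-leafA {centreA} _ = refl
linked-leafA {centreB} ()
linked-leafA {leafB}   ()

linked-leafB : ∀ {q} → T (linked leafB q) → q ≡ centreB
linked-leafB {leafA}   ()
linked-leafB {centreA} ()
linked-leafB {centreB} _ = refl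
linked-leafB {leafB}   ()

module LabelledDoubleStar {n : ℕ} (label : Fin n → Role) {a b : Fin n}
  (label-a : label a ≡ centreA) (only-a : ∀ {w} → label w ≡ centreA → w ≡ a)
  (label-b : label b ≡ centreB) (only-b : ∀ {w} → label w ≡ centreB → w ≡ b) where

  tree : Graph n
  tree = record
    { adj        = λ x y → linked (label x) (label y)
    ; adj-sym    = λ x y → linked-sym (label x) (label y)
    ; adj-irrefl = λ x → linked-irrefl (label x)
    }

  edge : ∀ {x y r q} → label x ≡ r → label y ≡ q → T (linked r q) → Edge tree x y
  edge refl refl e = e

  edge-labels : ∀ {x y r q} → label x ≡ r → label y ≡ q → Edge tree x y → T (linked r q)
  edge-labels refl refl e = e

  a≢b : a ≢ b
  a≢b refl with trans (sym label-a) label-b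
  ... | ()

  data LabelView (x : Fin n) : Set where
    at-a   : x ≡ a → LabelView x
    at-b   : x ≡ b → LabelView x
    leaf-a : label x ≡ leafA → LabelView x
    leaf-b : label x ≡ leafB → LabelView x

  labelView : ∀ x → LabelView x
  labelView x with label x in lx
  ... | leafA   = leaf-a lx
  ... | centreA = at-a (only-a lx)
  ... | centreB = at-b (only-b lx)
  ... | leafB   = leaf-b lx

  leafA-neighbour : ∀ {x y} → label x ≡ leafA → Edge tree x y → y ≡ a
  leafA-neighbour lx e = only-a (linked-leafA (edge-labels lx refl e))

  leafB-neighbour : ∀ {x y} → label x ≡ leafB → Edge tree x y → y ≡ b
  leafB-neighbour lx e = only-b (linked-leafB (edge-labels lx refl e))

  walk-to-a : ∀ x → ∃[ k ] Walk tree x a k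
  walk-to-a x with labelView x
  ... | at-a refl = 0 , nil
  ... | at-b refl = 1 , cons (edge label-b label-a _) nil
  ... | leaf-a lx = 1 , cons (edge lx label-a _) nil
  ... | leaf-b lx = 2 , cons (edge lx label-b _) (cons (edge label-b label-a _) nil)

  branch-point : ∀ {x y z} → Edge tree x y → Edge tree x z → y ≢ z → x ≡ a ⊎ x ≡ b
  branch-point {x} e₁ e₂ y≢z with labelView x
  ... | at-a x≡a = inj₁ x≡a
  ... | at-b x≡b = inj₂ x≡b
  ... | leaf-a lx = ⊥-elim (y≢z (trans (leafA-neighbour lx e₁) (sym (leafA-neighbour lx e₂))))
  ... | leaf-b lx = ⊥-elim (y≢z (trans (leafB-neighbour lx e₁) (sym (leafB-neighbour lx e₂))))

  isTree : IsTree tree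
  isTree = connected-via a walk-to-a , two-branch-points⇒acyclic tree branch-point

  #_ : Role → ℕ
  # r = count (λ w → ⌊ label w ≟ r ⌋)

  #-positive : ∀ {w r} → label w ≡ r → 0 < # r
  #-positive lw = count-positive (λ w → ⌊ label w ≟ _ ⌋) (fromWitness lw)

  #centreA≡1 : # centreA ≡ 1
  #centreA≡1 = count-unique _ (fromWitness label-a) (only-a ∘ toWitness)

  #centreB≡1 : # centreB ≡ 1
  #centreB≡1 = count-unique _ (fromWitness label-b) (only-b ∘ toWitness)

  degree-via-label : ∀ {x r} → label x ≡ r → degree tree x ≡ count (λ w → linked r (label w))
  degree-via-label {x} refl = degree≡count tree x

  degree-leafA : ∀ {x} → label x ≡ leafA → degree tree x ≡ 1
  degree-leafA lx = trans (degree-via-label lx)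
    (count-unique _ (subst (T ∘ linked leafA) (sym label-a) _) (only-a ∘ linked-leafA))

  degree-leafB : ∀ {x} → label x ≡ leafB → degree tree x ≡ 1
  degree-leafB lx = trans (degree-via-label lx)
    (count-unique _ (subst (T ∘ linked leafB) (sym label-b) _) (only-b ∘ linked-leafB))

  degree-a : degree tree a ≡ suc (# leafA)
  degree-a = begin
    degree tree a                                              ≡⟨ degree-via-label label-a ⟩
    count (λ w → linked centreA (label w))                     ≡⟨ count-cong (neighbours ∘ label) ⟩
    count (λ w → ⌊ label w ≟ centreB ⌋ ∨ ⌊ label w ≟ leafA ⌋) ≡⟨ count-∨ (disjoint ∘ label) ⟩
    # centreB + # leafA                                        ≡⟨ cong (_+ # leafA) #centreB≡1 ⟩
    suc (# leafA)                                              ∎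
    where
    neighbours : ∀ q → linked centreA q ≡ ⌊ q ≟ centreB ⌋ ∨ ⌊ q ≟ leafA ⌋
    neighbours = everyRole _ refl refl refl refl
    disjoint : ∀ q → ⌊ q ≟ centreB ⌋ ∧ ⌊ q ≟ leafA ⌋ ≡ false
    disjoint = everyRole _ refl refl refl refl

  degree-b : degree tree b ≡ suc (# leafB)
  degree-b = begin
    degree tree b                                              ≡⟨ degree-via-label label-b ⟩
    count (λ w → linked centreB (label w))                     ≡⟨ count-cong (neighbours ∘ label) ⟩
    count (λ w → ⌊ label w ≟ centreA ⌋ ∨ ⌊ label w ≟ leafB ⌋) ≡⟨ count-∨ (disjoint ∘ label) ⟩
    # centreA + # leafB                                        ≡⟨ cong (_+ # leafB) #centreA≡1 ⟩
    suc (# leafB)                                              ∎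
    where
    neighbours : ∀ q → linked centreB q ≡ ⌊ q ≟ centreA ⌋ ∨ ⌊ q ≟ leafB ⌋
    neighbours = everyRole _ refl refl refl refl
    disjoint : ∀ q → ⌊ q ≟ centreA ⌋ ∧ ⌊ q ≟ leafB ⌋ ≡ false
    disjoint = everyRole _ refl refl refl refl

  #total : n ≡ suc (suc (# leafA + # leafB))
  #total =
    trans (sym count-true) (trans (count-cong (cover ∘ label)) (trans (count-∨ (disjoint₁ ∘ label))
      (cong₂ _+_ #centreA≡1 (trans (count-∨ (disjoint₂ ∘ label))
        (cong₂ _+_ #centreB≡1 (count-∨ (disjoint₃ ∘ label)))))))
    where
    cover : ∀ q → true ≡ ⌊ q ≟ centreA ⌋ ∨ (⌊ q ≟ centreB ⌋ ∨ (⌊ q ≟ leafA ⌋ ∨ ⌊ q ≟ leafB ⌋))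
    cover = everyRole _ refl refl refl refl
    disjoint₁ : ∀ q → ⌊ q ≟ centreA ⌋ ∧ (⌊ q ≟ centreB ⌋ ∨ (⌊ q ≟ leafA ⌋ ∨ ⌊ q ≟ leafB ⌋)) ≡ false
    disjoint₁ = everyRole _ refl refl refl refl
    disjoint₂ : ∀ q → ⌊ q ≟ centreB ⌋ ∧ (⌊ q ≟ leafA ⌋ ∨ ⌊ q ≟ leafB ⌋) ≡ false
    disjoint₂ = everyRole _ refl refl refl refl
    disjoint₃ : ∀ q → ⌊ q ≟ leafA ⌋ ∧ ⌊ q ≟ leafB ⌋ ≡ false
    disjoint₃ = everyRole _ refl refl refl refl

  isOddDoubleStar : Even n → Even (# leafA) → 0 < # leafA → 0 < # leafB → IsOddDoubleStar tree
  isOddDoubleStar even-n even-leafA@(k , #leafA≡2k) leafA-inhabited leafB-inhabited =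
    ( isTree , a , b , a≢b
    , subst (2 ≤_) (sym degree-a) (s≤s leafA-inhabited)
    , subst (2 ≤_) (sym degree-b) (s≤s leafB-inhabited)
    , branch-vertex )
    , odd-degree
    where
    even-leafB : Even (# leafB)
    even-leafB = even-+-cancelˡ even-leafA (even-+-cancelˡ (1 , refl) (subst Even #total even-n))

    branch-vertex : ∀ v → 2 ≤ degree tree v → v ≡ a ⊎ v ≡ b
    branch-vertex v 2≤deg with labelView v
    ... | at-a v≡a = inj₁ v≡a
    ... | at-b v≡b = inj₂ v≡b
    ... | leaf-a lv with s≤s () ← subst (2 ≤_) (degree-leafA lv) 2≤deg
    ... | leaf-b lv with s≤s () ← subst (2 ≤_) (degree-leafB lv) 2≤deg

    odd-degree : ∀ v → Odd (degree tree v)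
    odd-degree v with labelView v | even-leafB
    ... | at-a refl | _               = k , trans degree-a (cong suc #leafA≡2k)
    ... | at-b refl | (j , #leafB≡2j) = j , trans degree-b (cong suc #leafB≡2j)
    ... | leaf-a lv | _               = 0 , degree-leafA lv
    ... | leaf-b lv | _               = 0 , degree-leafB lv

  tree⊆complement : (G : Graph n) → ¬ Edge G a b →
    (∀ {w} → label w ≡ leafA → ¬ Edge G a w) → (∀ {w} → label w ≡ leafB → ¬ Edge G b w) →
    SpanningSubgraph tree (complement G)
  tree⊆complement G ¬ab ¬a-leafA ¬b-leafB x y e = complement-edge G (non-edge e) (edge⇒≢ tree e)
    where
    non-edge : ∀ {x y} → Edge tree x y → ¬ Edge G x y
    non-edge {x} {y} e with labelView x
    ... | leaf-a lx =
      subst (λ z → ¬ Edge G x z) (sym (leafA-neighbour lx e)) (¬a-leafA lx ∘ edge-sym G)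
    ... | leaf-b lx =
      subst (λ z → ¬ Edge G x z) (sym (leafB-neighbour lx e)) (¬b-leafB lx ∘ edge-sym G)
    ... | at-a refl with labelView y
    ...   | at-a refl = edge-irrefl G
    ...   | at-b refl = ¬ab
    ...   | leaf-a ly = ¬a-leafA ly
    ...   | leaf-b ly = ⊥-elim (edge-labels label-a ly e)
    non-edge {x} {y} e | at-b refl with labelView y
    ...   | at-a refl = ¬ab ∘ edge-sym G
    ...   | at-b refl = edge-irrefl G
    ...   | leaf-a ly = ⊥-elim (edge-labels label-b ly e)
    ...   | leaf-b ly = ¬b-leafB ly

-- atA w says that w is to become a leaf at a rather than at b.
record LeafAssignment (G : Graph n) (a b : Fin n) : Set where
  field
    atA              : Fin n → Bool
    a∉atA            : ¬ T (atA a)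
    b∉atA            : ¬ T (atA b)
    a-neighbours∉atA : ∀ {w} → Edge G a w → ¬ T (atA w)
    b-neighbours∈atA : ∀ {w} → Edge G b w → T (atA w)

module AssignmentLabel {G : Graph n} {a b : Fin n} (a≢b : a ≢ b) (L : LeafAssignment G a b) where
  open LeafAssignment L

  label : Fin n → Role
  label w = if ⌊ w ≟ a ⌋ then centreA
       else if ⌊ w ≟ b ⌋ then centreB
       else if atA w then leafA else leafB

  label-a : label a ≡ centreA
  label-a with a ≟ a
  ... | yes _   = refl
  ... | no a≢a = ⊥-elim (a≢a refl)

  label-b : label b ≡ centreB
  label-b with b ≟ a | b ≟ b
  ... | yes b≡a | _      = ⊥-elim (a≢b (sym b≡a))
  ... | no _    | yes _  = refl
  ... | no _    | no b≢b = ⊥-elim (b≢b refl)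

  only-a : ∀ {w} → label w ≡ centreA → w ≡ a
  only-a {w} eq with w ≟ a | w ≟ b | atA w
  ... | yes w≡a | _     | _     = w≡a
  only-a () | no _ | yes _ | _
  only-a () | no _ | no _  | true
  only-a () | no _ | no _  | false

  only-b : ∀ {w} → label w ≡ centreB → w ≡ b
  only-b {w} eq with w ≟ a | w ≟ b | atA w
  ... | no _ | yes w≡b | _ = w≡b
  only-b () | yes _ | _    | _
  only-b () | no _  | no _ | true
  only-b () | no _  | no _ | false

  leafA⇒atA : ∀ {w} → label w ≡ leafA → T (atA w)
  leafA⇒atA {w} eq with w ≟ a | w ≟ b | atA w
  ... | no _ | no _ | true = _
  leafA⇒atA () | yes _ | _     | _
  leafA⇒atA () | no _  | yes _ | _
  leafA⇒atA () | no _  | no _  | false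

  leafB⇒∉atA : ∀ {w} → label w ≡ leafB → ¬ T (atA w)
  leafB⇒∉atA {w} eq with w ≟ a | w ≟ b | atA w
  ... | no _ | no _ | false = λ ()
  leafB⇒∉atA () | yes _ | _     | _
  leafB⇒∉atA () | no _  | yes _ | _
  leafB⇒∉atA () | no _  | no _  | true

  atA⇒leafA : ∀ {w} → T (atA w) → label w ≡ leafA
  atA⇒leafA {w} t with w ≟ a | w ≟ b | atA w in eq
  ... | yes refl | _        | _     = ⊥-elim (a∉atA (subst T (sym eq) t))
  ... | no _     | yes refl | _     = ⊥-elim (b∉atA (subst T (sym eq) t))
  ... | no _     | no _     | true  = refl
  ... | no _     | no _     | false = ⊥-elim t

  off-centres⇒leafB : ∀ {w} → w ≢ a → w ≢ b → ¬ T (atA w) → label w ≡ leafB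
  off-centres⇒leafB {w} w≢a w≢b ¬t with w ≟ a | w ≟ b | atA w in eq
  ... | yes w≡a | _       | _     = ⊥-elim (w≢a w≡a)
  ... | no _    | yes w≡b | _     = ⊥-elim (w≢b w≡b)
  ... | no _    | no _    | false = refl
  ... | no _    | no _    | true  = ⊥-elim (¬t _)

  leafA-fibre : ∀ w → ⌊ label w ≟ leafA ⌋ ≡ atA w
  leafA-fibre w with w ≟ a | w ≟ b | atA w in eq
  ... | no _     | no _     | true  = refl
  ... | no _     | no _     | false = refl
  ... | yes refl | _        | false = refl
  ... | yes refl | _        | true  = ⊥-elim (a∉atA (subst T (sym eq) _))
  ... | no _     | yes refl | false = refl
  ... | no _     | yes refl | true  = ⊥-elim (b∉atA (subst T (sym eq) _))

assignment⇒complement-odd-double-star : (G : Graph n) {a b : Fin n} → a ≢ b → ¬ Edge G a b →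
  ∃[ w ] Edge G a w → ∃[ w ] Edge G b w → Even n →
  (L : LeafAssignment G a b) → Even (count (LeafAssignment.atA L)) →
  HasSpanningOddDoubleStar (complement G)
assignment⇒complement-odd-double-star G {a} {b} a≢b ¬ab (wa , a-wa) (wb , b-wb) even-n L even-atA =
  tree
  , tree⊆complement G ¬ab (λ lw e → a-neighbours∉atA L e (leafA⇒atA lw))
                          (λ lw → leafB⇒∉atA lw ∘ b-neighbours∈atA L)
  , isOddDoubleStar even-n (subst Even (sym (count-cong leafA-fibre)) even-atA)
      (#-positive {wb} (atA⇒leafA (b-neighbours∈atA L b-wb)))
      (#-positive {wa} (off-centres⇒leafB (edge⇒≢ G a-wa ∘ sym) (λ { refl → ¬ab a-wa })
                                          (a-neighbours∉atA L a-wa)))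
  where
  open LeafAssignment
  open AssignmentLabel a≢b L
  open LabelledDoubleStar label label-a only-a label-b only-b

¬T-∨ : ∀ {x y} → ¬ T x → ¬ T y → ¬ T (x ∨ y)
¬T-∨ ¬x ¬y = [ ¬x , ¬y ] ∘ Equivalence.to T-∨

assign-to-a : {G : Graph n} {a b f : Fin n} → LeafAssignment G a b →
  f ≢ a → f ≢ b → ¬ Edge G a f → LeafAssignment G a b
assign-to-a {G = G} {a} {b} {f} L f≢a f≢b ¬af = record
  { atA              = λ w → atA L w ∨ ⌊ w ≟ f ⌋
  ; a∉atA            = ¬T-∨ (a∉atA L) (f≢a ∘ sym ∘ toWitness)
  ; b∉atA            = ¬T-∨ (b∉atA L) (f≢b ∘ sym ∘ toWitness)
  ; a-neighbours∉atA = λ e → ¬T-∨ (a-neighbours∉atA L e)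
                                   (λ t → ¬af (subst (Edge G a) (toWitness t) e))
  ; b-neighbours∈atA = λ e → Equivalence.from T-∨ (inj₁ (b-neighbours∈atA L e))
  }
  where open LeafAssignment

module DistanceAtLeastFour (G : Graph n) {u v : Fin n} (far : ∀ k → Walk G u v k → 4 ≤ k) where

  Near : Fin n → Set
  Near x = x ≡ u ⊎ Edge G u x

  -- The bound is an implicit proof of a closed boolean test, so it is found automatically.
  no-short-walk : ∀ {x k} → Near x → Walk G x v k → {T (k <ᵇ 3)} → ⊥
  no-short-walk (inj₁ refl) p {k<3} = <⇒≱ (m<n⇒m<1+n (<ᵇ⇒< _ 3 k<3)) (far _ p)
  no-short-walk (inj₂ ux)   p {k<3} = <⇒≱ (s≤s (<ᵇ⇒< _ 3 k<3)) (far _ (cons ux p))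

  u≢v : u ≢ v
  u≢v refl = no-short-walk (inj₁ refl) nil

  ¬uv : ¬ Edge G u v
  ¬uv uv = no-short-walk (inj₁ refl) (cons uv nil)

  no-common-neighbour : ∀ {w} → Edge G u w → ¬ Edge G v w
  no-common-neighbour uw vw = no-short-walk (inj₂ uw) (cons (edge-sym G vw) nil)

  v-neighbours-at-u : LeafAssignment G u v
  v-neighbours-at-u = record
    { atA              = adj G v
    ; a∉atA            = ¬uv ∘ edge-sym G
    ; b∉atA            = edge-irrefl G
    ; a-neighbours∉atA = no-common-neighbour
    ; b-neighbours∈atA = id
    }

  -- The first vertex of the walk that is neither u nor a neighbour of u lies at distance 2 from u.
  distance-two-vertex : ∀ {x k} → Near x → Walk G x v k →
    ∃[ w ] (w ≢ u × w ≢ v × ¬ Edge G u w × ¬ Edge G v w)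
  distance-two-vertex near nil = ⊥-elim (no-short-walk near nil)
  distance-two-vertex near (cons {w = w} xw p) with w ≟ u | T? (adj G u w)
  ... | yes w≡u | _      = distance-two-vertex (inj₁ w≡u) p
  ... | no _    | yes uw = distance-two-vertex (inj₂ uw) p
  ... | no w≢u  | no ¬uw with w ≟ v | T? (adj G v w)
  ...   | yes refl | _      = ⊥-elim (no-short-walk near (cons xw nil))
  ...   | no _     | yes vw = ⊥-elim (no-short-walk near (cons xw (cons (edge-sym G vw) nil)))
  ...   | no w≢v   | no ¬vw = w , w≢u , w≢v , ¬uw , ¬vw

corollary3p2 : (n : ℕ) → Even n → (G : Graph n) → Connected G → DiameterAtLeast G 4
    → Σ (Graph n) (λ T′ → SpanningSubgraph T′ (complement G) × IsOddDoubleStar T′)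
corollary3p2 n even-n G connected (u , v , far) = odd-double-star
  where
  open DistanceAtLeastFour G far

  from : (L : LeafAssignment G u v) → Even (count (LeafAssignment.atA L)) →
         HasSpanningOddDoubleStar (complement G)
  from = assignment⇒complement-odd-double-star G u≢v ¬uv
           (neighbour connected u≢v) (neighbour connected (u≢v ∘ sym)) even-n

  odd-double-star : HasSpanningOddDoubleStar (complement G)
  odd-double-star
    with even⊎odd (count (adj G v)) | distance-two-vertex (inj₁ refl) (proj₂ (connected u v))
  ... | inj₁ even-v | _ = from v-neighbours-at-u even-v
  ... | inj₂ odd-v  | f , f≢u , f≢v , ¬uf , ¬vf =
    from (assign-to-a v-neighbours-at-u f≢u f≢v ¬uf)
         (subst Even (sym (count-insert (adj G v) ¬vf)) (odd⇒even-suc odd-v))
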